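{- Let $(K,+,\cdot,\|,0,1)$ be a trioid such that $(K,\le)$ is a complete lattice, $\cdot$ distributes over arbitrary suprema in each argument (so $(K,+,\cdot)$ is a quantale), and $\|$ distributes over arbitrary suprema. Let the Kleene star be $x^\star=\sum_{i\ge 0}x^i$ (with $x^0=1$, $x^{i+1}=x\cdot x^i$) and $x^+=x\cdot x^\star$. If $r\in K$ satisfies $r\|(x\cdot y)=(r\|x)\cdot(r\|y)$ for all $x,y\in K$, then $r\|x^+\le (r\|x)^+$ for all $x\in K$.
   Context: A dioid is a structure $(S,+,\cdot,0,1)$ where $(S,+,0)$ is a commutative monoid, $(S,\cdot,1)$ is a monoid, $\cdot$ distributes over $+$ from both sides, $x\cdot 0=0=0\cdot x$, and $x+x=x$; the order is $x\le y\iff x+y=y$, and suprema refer to this order. A trioid is a structure $(S,+,\cdot,\|,0,1)$ such that $(S,+,\cdot,0,1)$ is a dioid and $(S,+,\|,0,1)$ is a dioid in which $\|$ is commutative. -}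

module Defs where

open import Level using (Level; suc; Lift; lift; lower)
open import Data.Nat using (ℕ; zero) renaming (suc to sucℕ)
open import Relation.Binary.PropositionalEquality using (_≡_)

-- Arbitrary suprema are given as suprema of families indexed by any
-- type I : Set c (c = level of the carrier), which covers arbitrary
-- subsets P : K → Set c via the family proj₁ : Σ K P → K.
record CompleteTrioid (c : Level) : Set (suc c) where
  infixl 6 _+_
  infixl 7 _·_
  infixl 7 _∥_
  infix 4 _≤_
  field
    K   : Set c
    _+_ : K → K → K
    _·_ : K → K → K
    _∥_ : K → K → K
    𝟎   : K
    𝟏   : K
    +-assoc  : ∀ x y z → (x + y) + z ≡ x + (y + z)
    +-comm   : ∀ x y → x + y ≡ y + x
    +-idˡ    : ∀ x → 𝟎 + x ≡ x
    +-idem   : ∀ x → x + x ≡ x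
    ·-assoc  : ∀ x y z → (x · y) · z ≡ x · (y · z)
    ·-idˡ    : ∀ x → 𝟏 · x ≡ x
    ·-idʳ    : ∀ x → x · 𝟏 ≡ x
    ·-distribˡ : ∀ x y z → x · (y + z) ≡ x · y + x · z
    ·-distribʳ : ∀ x y z → (y + z) · x ≡ y · x + z · x
    ·-zeroˡ  : ∀ x → 𝟎 · x ≡ 𝟎
    ·-zeroʳ  : ∀ x → x · 𝟎 ≡ 𝟎
    ∥-assoc  : ∀ x y z → (x ∥ y) ∥ z ≡ x ∥ (y ∥ z)
    ∥-comm   : ∀ x y → x ∥ y ≡ y ∥ x
    ∥-idˡ    : ∀ x → 𝟏 ∥ x ≡ x
    ∥-distribˡ : ∀ x y z → x ∥ (y + z) ≡ x ∥ y + x ∥ z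
    ∥-zeroˡ  : ∀ x → 𝟎 ∥ x ≡ 𝟎

  _≤_ : K → K → Set c
  x ≤ y = x + y ≡ y

  field
    ⋁      : {I : Set c} → (I → K) → K
    ⋁-ub   : {I : Set c} (f : I → K) (i : I) → f i ≤ ⋁ f
    ⋁-least : {I : Set c} (f : I → K) (z : K) → (∀ i → f i ≤ z) → ⋁ f ≤ z
    ·-⋁ˡ : {I : Set c} (x : K) (f : I → K) → x · ⋁ f ≡ ⋁ (λ i → x · f i)
    ·-⋁ʳ : {I : Set c} (x : K) (f : I → K) → ⋁ f · x ≡ ⋁ (λ i → f i · x)
    ∥-⋁  : {I : Set c} (x : K) (f : I → K) → x ∥ ⋁ f ≡ ⋁ (λ i → x ∥ f i)

  pow : K → ℕ → K
  pow x zero     = 𝟏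
  pow x (sucℕ i) = x · pow x i

  _⋆ : K → K
  x ⋆ = ⋁ {I = Lift c ℕ} (λ i → pow x (lower i))

  _⁺ : K → K
  x ⁺ = x · (x ⋆)

module Submission where

-- In a complete trioid, x⁺ = x · ⋁ᵢ xⁱ = ⋁ᵢ x^(i+1) because ·
-- distributes over suprema.  Since ∥ also distributes over suprema,
-- r ∥ x⁺ = ⋁ᵢ (r ∥ x^(i+1)).  If r ∥ (x · y) = (r ∥ x) · (r ∥ y) for all
-- x, y, an induction on i gives r ∥ x^(i+1) = (r ∥ x)^(i+1), so the two
-- suprema agree termwise and r ∥ x⁺ = (r ∥ x)⁺; the inequality of the
-- theorem is the reflexive instance of this equality.

open import Defs
open import Level using (Level; Lift; lower)
open import Data.Nat using (ℕ; zero; suc)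
open import Relation.Binary.PropositionalEquality
  using (_≡_; sym; cong; subst; module ≡-Reasoning)

module CompleteTrioidProperties {c : Level} (T : CompleteTrioid c) where
  open CompleteTrioid T
  open ≡-Reasoning

  ≤-refl : ∀ x → x ≤ x
  ≤-refl = +-idem

  ≤-antisym : ∀ {x y} → x ≤ y → y ≤ x → x ≡ y
  ≤-antisym {x} {y} x≤y y≤x = begin
    x      ≡⟨ sym y≤x ⟩
    y + x  ≡⟨ +-comm y x ⟩
    x + y  ≡⟨ x≤y ⟩
    y      ∎

  ≤-respˡ : ∀ {x x′ z} → x ≡ x′ → x′ ≤ z → x ≤ z
  ≤-respˡ {z = z} x≡x′ = subst (_≤ z) (sym x≡x′)

  ≤-trans : ∀ {x y z} → x ≤ y → y ≤ z → x ≤ z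
  ≤-trans {x} {y} {z} x≤y y≤z = begin
    x + z        ≡⟨ cong (x +_) (sym y≤z) ⟩
    x + (y + z)  ≡⟨ sym (+-assoc x y z) ⟩
    (x + y) + z  ≡⟨ cong (_+ z) x≤y ⟩
    y + z        ≡⟨ y≤z ⟩
    z            ∎

  ⋁-mono : ∀ {I : Set c} (f g : I → K) → (∀ i → f i ≤ g i) → ⋁ f ≤ ⋁ g
  ⋁-mono f g f≤g = ⋁-least f (⋁ g) λ i → ≤-trans (f≤g i) (⋁-ub g i)

  -- Pointwise equal families have equal suprema (a substitute for
  -- function extensionality, derived from the universal property of ⋁).
  ⋁-cong : ∀ {I : Set c} (f g : I → K) → (∀ i → f i ≡ g i) → ⋁ f ≡ ⋁ g
  ⋁-cong f g f≡g = ≤-antisym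
    (⋁-mono f g λ i → ≤-respˡ (f≡g i) (≤-refl (g i)))
    (⋁-mono g f λ i → ≤-respˡ (sym (f≡g i)) (≤-refl (f i)))

  ⁺-as-⋁ : ∀ x → x ⁺ ≡ ⋁ (λ (i : Lift c ℕ) → pow x (suc (lower i)))
  ⁺-as-⋁ x = ·-⋁ˡ x (λ i → pow x (lower i))

  -- An element r for which r ∥ _ is multiplicative commutes r ∥ _ with
  -- positive powers.  (The zeroth power is excluded: r ∥ 1 = r, not 1.)
  ∥-pow : ∀ r → (∀ x y → r ∥ (x · y) ≡ (r ∥ x) · (r ∥ y)) →
          ∀ x n → r ∥ pow x (suc n) ≡ pow (r ∥ x) (suc n)
  ∥-pow r hom x zero = begin
    r ∥ (x · 𝟏)  ≡⟨ cong (r ∥_) (·-idʳ x) ⟩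
    r ∥ x        ≡⟨ sym (·-idʳ (r ∥ x)) ⟩
    (r ∥ x) · 𝟏  ∎
  ∥-pow r hom x (suc n) = begin
    r ∥ (x · pow x (suc n))            ≡⟨ hom x (pow x (suc n)) ⟩
    (r ∥ x) · (r ∥ pow x (suc n))      ≡⟨ cong ((r ∥ x) ·_) (∥-pow r hom x n) ⟩
    (r ∥ x) · pow (r ∥ x) (suc n)      ∎

  ∥-⁺ : ∀ r → (∀ x y → r ∥ (x · y) ≡ (r ∥ x) · (r ∥ y)) →
        ∀ x → r ∥ (x ⁺) ≡ (r ∥ x) ⁺
  ∥-⁺ r hom x = begin
    r ∥ (x ⁺)                                    ≡⟨ cong (r ∥_) (⁺-as-⋁ x) ⟩
    r ∥ ⋁ (λ i → pow x (suc (lower i)))          ≡⟨ ∥-⋁ r _ ⟩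
    ⋁ (λ i → r ∥ pow x (suc (lower i)))          ≡⟨ ⋁-cong _ _ (λ i → ∥-pow r hom x (lower i)) ⟩
    ⋁ (λ i → pow (r ∥ x) (suc (lower i)))        ≡⟨ sym (⁺-as-⋁ (r ∥ x)) ⟩
    (r ∥ x) ⁺                                    ∎

theorem2 : ∀ {c : Level} (T : CompleteTrioid c) → let open CompleteTrioid T in
    ∀ (r : K) → (∀ x y → r ∥ (x · y) ≡ (r ∥ x) · (r ∥ y)) →
    ∀ (x : K) → r ∥ (x ⁺) ≤ (r ∥ x) ⁺
theorem2 T r hom x = ≤-respˡ (∥-⁺ r hom x) (≤-refl ((r ∥ x) ⁺))
  where
  open CompleteTrioid T
  open CompleteTrioidProperties T
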